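{- Let $m\ge1$ be an integer and let $\varphi$ be a $(3m:m)$-colouring of a $4$-cycle $v_1v_2v_3v_4$ with margin $b$. Then there exist pairwise disjoint sets $A_1,A_2,A_3,B_1,B_2,B_3,C_1,C_2,C_3\subset [3m]$ such that $|A_1|=|A_2|=|A_3|\ge b$, $|B_1|=|B_2|=|B_3|\ge b$, $|C_1|=|C_2|=|C_3|\ge b$, and $\varphi(v_1)=A_1\cup B_1\cup C_1$, $\varphi(v_2)=A_2\cup B_2\cup C_2$, $\varphi(v_3)=A_1\cup B_3\cup C_1$, $\varphi(v_4)=A_3\cup B_2\cup C_2$.
   Context: $[c]=\{1,\dots,c\}$. A colouring of a graph $G$ by subsets of $[c]$ is a map $\varphi:V(G)\to 2^{[c]}$ with $\varphi(u)\cap\varphi(v)=\emptyset$ for every edge $uv$; it is a $(c:a)$-colouring if $|\varphi(v)|=a$ for all $v$. The margin of a $(3m:m)$-colouring $\varphi$ of a $4$-cycle $v_1v_2v_3v_4$ is the minimum of $|\varphi(v_1)\setminus\varphi(v_3)|$, $|\varphi(v_2)\setminus\varphi(v_4)|$ and $3m-\bigl|\bigcup_{i=1}^4\varphi(v_i)\bigr|$. -}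

module Defs where

open import Data.Nat using (ℕ; suc; _*_; _∸_; _⊓_)
open import Data.Fin using (Fin; zero; suc)
open import Data.Fin.Subset using (Subset; _∩_; _∪_; _─_; ∣_∣; ⊥)
open import Data.Product using (_×_)
open import Relation.Binary.PropositionalEquality using (_≡_; _≢_)

Disjoint : ∀ {n} → Subset n → Subset n → Set
Disjoint p q = p ∩ q ≡ ⊥

v₁ v₂ v₃ v₄ : Fin 4
v₁ = zero
v₂ = suc zero
v₃ = suc (suc zero)
v₄ = suc (suc (suc zero))

IsC4Colouring : ∀ {c} → (Fin 4 → Subset c) → Set
IsC4Colouring φ =
  Disjoint (φ v₁) (φ v₂) × Disjoint (φ v₂) (φ v₃) ×
  Disjoint (φ v₃) (φ v₄) × Disjoint (φ v₄) (φ v₁)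

IsC4ColouringOf : (c a : ℕ) → (Fin 4 → Subset c) → Set
IsC4ColouringOf c a φ = IsC4Colouring φ × (∀ v → ∣ φ v ∣ ≡ a)

margin : (m : ℕ) → (Fin 4 → Subset (3 * m)) → ℕ
margin m φ =
  ∣ φ v₁ ─ φ v₃ ∣ ⊓ ∣ φ v₂ ─ φ v₄ ∣ ⊓
  ((3 * m) ∸ ∣ φ v₁ ∪ φ v₂ ∪ φ v₃ ∪ φ v₄ ∣)

PairwiseDisjoint : ∀ {n k} → (Fin k → Subset n) → Set
PairwiseDisjoint {k = k} S = ∀ (i j : Fin k) → i ≢ j → Disjoint (S i) (S j)

-- Label each point of [3m] by the part it should belong to.  Since adjacent colour classes are
-- disjoint, a point lies in φ(v₁) ∩ φ(v₃) (label A₁), in φ(v₂) ∩ φ(v₄) (label B₂), in exactly one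
-- colour class (B₁, A₂, B₃ or A₃), or in none (C₃).  Counting the points gives |B₁| = |B₃| =: β,
-- |A₂| = |A₃| =: α and, with γ := |C₃|, α + β + γ = m; hence |φ(v₁) ∩ φ(v₃)| = α + γ and
-- |φ(v₂) ∩ φ(v₄)| = β + γ.  The parts A₁ and C₁ (and likewise B₂ and C₂) lie in the same colour
-- classes, so relabelling γ of the A₁-points as C₁ and γ of the B₂-points as C₂ leaves φ unchanged
-- and balances all three triples.  Finally the margin is min(β, α, γ).

module Submission where

open import Defs
open import Data.Nat using (ℕ; suc; _*_; _≤_)
open import Data.Fin using (Fin; zero; suc)
open import Data.Fin.Subset using (Subset; _∪_; ∣_∣)
open import Data.Product using (_×_; Σ; ∃)
open import Data.Vec using ([]; _∷_; lookup)
open import Relation.Binary.PropositionalEquality using (_≡_)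

open import Data.Bool using (Bool; true; false; _∧_; _∨_; not)
open import Data.Bool.Properties using (∨-zeroʳ) renaming (_≟_ to _≟ᵇ_)
open import Data.Nat using (zero; _+_; _∸_; _⊓_)
open import Data.Nat.Properties
  using (+-suc; +-identityʳ; +-cancelˡ-≡; +-cancelʳ-≡; m≤m+n; m≤n⇒m⊓n≡m; ⊓-zeroʳ;
         m⊓n≤m; m⊓n≤n; ≤-trans; ≤-reflexive; m∸[m∸n]≡n)
open import Data.Nat.Tactic.RingSolver using (solve-∀)
open import Data.Fin.Properties using (_≟_; all?)
open import Data.Fin.Subset using (_─_; ∁; ⊥)
open import Data.Fin.Subset.Properties using (∩-distribˡ-∪; ∪-identityʳ; ∣∁p∣≡n∸∣p∣; ∣p∣≤n)
open import Data.Vec using (Vec; map; zipWith; tabulate; sum)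
open import Data.Vec.Properties using (map-cong; map-∘; lookup∘tabulate; ∷-injectiveˡ; ∷-injectiveʳ)
open import Data.Product using (_,_; proj₁; proj₂)
open import Function using (_∘_)
open import Relation.Nullary.Decidable using (does; yes; no; True; toWitness; dec-true; dec-false)
open import Relation.Binary.PropositionalEquality using (_≢_; refl; sym; trans; cong; cong₂; _≗_; module ≡-Reasoning)

zipWith-map-map : ∀ {n} {A B C D : Set} (_⊕_ : B → C → D) (f : A → B) (g : A → C) (xs : Vec A n) →
  zipWith _⊕_ (map f xs) (map g xs) ≡ map (λ x → f x ⊕ g x) xs
zipWith-map-map _⊕_ f g []       = refl
zipWith-map-map _⊕_ f g (x ∷ xs) = cong (f x ⊕ g x ∷_) (zipWith-map-map _⊕_ f g xs)

decide-≗ : ∀ {k} {f g : Fin k → Bool} {ok : True (all? λ x → f x ≟ᵇ g x)} → f ≗ g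
decide-≗ {ok = ok} = toWitness ok

∣p∪q∣≡∣p∣+∣q∣ : ∀ {n} {p q : Subset n} → Disjoint p q → ∣ p ∪ q ∣ ≡ ∣ p ∣ + ∣ q ∣
∣p∪q∣≡∣p∣+∣q∣ {p = []}        {[]}        _ = refl
∣p∪q∣≡∣p∣+∣q∣ {p = true ∷ p}  {false ∷ q} d = cong suc (∣p∪q∣≡∣p∣+∣q∣ (∷-injectiveʳ d))
∣p∪q∣≡∣p∣+∣q∣ {p = false ∷ p} {true ∷ q}  d =
  trans (cong suc (∣p∪q∣≡∣p∣+∣q∣ (∷-injectiveʳ d))) (sym (+-suc ∣ p ∣ ∣ q ∣))
∣p∪q∣≡∣p∣+∣q∣ {p = false ∷ p} {false ∷ q} d = ∣p∪q∣≡∣p∣+∣q∣ (∷-injectiveʳ d)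
∣p∪q∣≡∣p∣+∣q∣ {p = true ∷ p}  {true ∷ q}  ()

disjoint-∪ : ∀ {n} {p q r : Subset n} → Disjoint p q → Disjoint p r → Disjoint p (q ∪ r)
disjoint-∪ {p = p} {q} {r} p∩q≡⊥ p∩r≡⊥ =
  trans (∩-distribˡ-∪ p q r) (trans (cong₂ _∪_ p∩q≡⊥ p∩r≡⊥) (∪-identityʳ ⊥))

sum-tabulate-0 : ∀ k → sum (tabulate {n = k} (λ _ → 0)) ≡ 0
sum-tabulate-0 zero    = refl
sum-tabulate-0 (suc k) = sum-tabulate-0 k

fibre : ∀ {k n} → Vec (Fin k) n → Fin k → Subset n
fibre t i = map (λ x → does (x ≟ i)) t

infix 9 _#_
_#_ : ∀ {k n} → Vec (Fin k) n → Fin k → ℕ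
t # i = ∣ fibre t i ∣

fibre-disjoint : ∀ {k n} (t : Vec (Fin k) n) {i j : Fin k} → i ≢ j → Disjoint (fibre t i) (fibre t j)
fibre-disjoint []      i≢j = refl
fibre-disjoint (x ∷ t) {i} {j} i≢j with x ≟ i
... | no _     = cong (false ∷_) (fibre-disjoint t i≢j)
... | yes refl = cong₂ _∷_ (dec-false (x ≟ j) i≢j) (fibre-disjoint t i≢j)

fibres-pairwiseDisjoint : ∀ {k n} (t : Vec (Fin k) n) → PairwiseDisjoint (lookup (tabulate (fibre t)))
fibres-pairwiseDisjoint t i j i≢j
  rewrite lookup∘tabulate (fibre t) i | lookup∘tabulate (fibre t) j = fibre-disjoint t i≢j

sum-fibres : ∀ {k n} (t : Vec (Fin k) n) → sum (tabulate (t #_)) ≡ n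
sum-fibres {k} []      = sum-tabulate-0 k
sum-fibres     (x ∷ t) = trans (cons x (fibre t)) (cong suc (sum-fibres t))
  where
  cons : ∀ {k n} (x : Fin k) (p : Fin k → Subset n) →
    sum (tabulate (λ i → ∣ does (x ≟ i) ∷ p i ∣)) ≡ suc (sum (tabulate (λ i → ∣ p i ∣)))
  cons zero    p = refl
  cons (suc x) p = trans (cong (∣ p zero ∣ +_) (cons x (λ i → p (suc i))))
                         (+-suc ∣ p zero ∣ (sum (tabulate (λ i → ∣ p (suc i) ∣))))

_∈₃_ : ∀ {k} → Fin k → Fin k × Fin k × Fin k → Bool
x ∈₃ (i , j , l) = does (x ≟ i) ∨ does (x ≟ j) ∨ does (x ≟ l)

fibres-∪₃ : ∀ {k n} (t : Vec (Fin k) n) (i j l : Fin k) →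
  fibre t i ∪ fibre t j ∪ fibre t l ≡ map (_∈₃ (i , j , l)) t
fibres-∪₃ t i j l = trans (cong (fibre t i ∪_) (zipWith-map-map _∨_ _ _ t)) (zipWith-map-map _∨_ _ _ t)

∣fibres-∪₃∣ : ∀ {k n} (t : Vec (Fin k) n) (i j l : Fin k) → i ≢ j → i ≢ l → j ≢ l →
  ∣ map (_∈₃ (i , j , l)) t ∣ ≡ t # i + (t # j + t # l)
∣fibres-∪₃∣ t i j l i≢j i≢l j≢l = begin
  ∣ map (_∈₃ (i , j , l)) t ∣          ≡⟨ cong ∣_∣ (sym (fibres-∪₃ t i j l)) ⟩
  ∣ fibre t i ∪ fibre t j ∪ fibre t l ∣ ≡⟨ ∣p∪q∣≡∣p∣+∣q∣ (disjoint-∪ (fibre-disjoint t i≢j) (fibre-disjoint t i≢l)) ⟩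
  t # i + ∣ fibre t j ∪ fibre t l ∣     ≡⟨ cong (t # i +_) (∣p∪q∣≡∣p∣+∣q∣ (fibre-disjoint t j≢l)) ⟩
  t # i + (t # j + t # l)               ∎
  where open ≡-Reasoning

rebalance : ∀ {k n} → ℕ → Fin k → Fin k → Vec (Fin k) n → Vec (Fin k) n
rebalance r x y [] = []
rebalance r x y (z ∷ t) with z ≟ x | z ≟ y
rebalance r       x y (z ∷ t) | no _ | no _ = z ∷ rebalance r x y t
rebalance zero    x y (z ∷ t) | _    | _    = y ∷ rebalance zero x y t
rebalance (suc r) x y (z ∷ t) | _    | _    = x ∷ rebalance r x y t

rebalance-map : ∀ {k n} {A : Set} (f : Fin k → A) {x y : Fin k} → f x ≡ f y →
  ∀ r (t : Vec (Fin k) n) → map f (rebalance r x y t) ≡ map f t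
rebalance-map f fx≡fy r [] = refl
rebalance-map f {x} {y} fx≡fy r (z ∷ t) with z ≟ x | z ≟ y
... | no _     | no _     = cong (f z ∷_) (rebalance-map f fx≡fy r t)
rebalance-map f fx≡fy zero    (z ∷ t) | yes refl | _        = cong₂ _∷_ (sym fx≡fy) (rebalance-map f fx≡fy zero t)
rebalance-map f fx≡fy zero    (z ∷ t) | no _     | yes refl = cong (f z ∷_) (rebalance-map f fx≡fy zero t)
rebalance-map f fx≡fy (suc r) (z ∷ t) | yes refl | _        = cong (f z ∷_) (rebalance-map f fx≡fy r t)
rebalance-map f fx≡fy (suc r) (z ∷ t) | no _     | yes refl = cong₂ _∷_ fx≡fy (rebalance-map f fx≡fy r t)

rebalance-#ˡ : ∀ {k n} {x y : Fin k} → x ≢ y → ∀ r (t : Vec (Fin k) n) →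
  rebalance r x y t # x ≡ r ⊓ ∣ fibre t x ∪ fibre t y ∣
rebalance-#ˡ x≢y r [] = sym (⊓-zeroʳ r)
rebalance-#ˡ {x = x} {y} x≢y r (z ∷ t) with z ≟ x | z ≟ y
... | no z≢x | no _ rewrite dec-false (z ≟ x) z≢x = rebalance-#ˡ x≢y r t
rebalance-#ˡ {x = x} {y} x≢y zero (z ∷ t) | yes refl | _
  rewrite dec-false (y ≟ x) (x≢y ∘ sym) = rebalance-#ˡ x≢y zero t
rebalance-#ˡ {x = x} {y} x≢y zero (z ∷ t) | no _ | yes refl
  rewrite dec-false (y ≟ x) (x≢y ∘ sym) = rebalance-#ˡ x≢y zero t
rebalance-#ˡ {x = x} {y} x≢y (suc r) (z ∷ t) | yes refl | _
  rewrite dec-true (x ≟ x) refl = cong suc (rebalance-#ˡ x≢y r t)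
rebalance-#ˡ {x = x} {y} x≢y (suc r) (z ∷ t) | no _ | yes refl
  rewrite dec-true (x ≟ x) refl = cong suc (rebalance-#ˡ x≢y r t)

rebalance-# : ∀ {k n} {x y : Fin k} → x ≢ y → ∀ r s (t : Vec (Fin k) n) → r + s ≡ t # x + t # y →
  rebalance r x y t # x ≡ r × rebalance r x y t # y ≡ s
rebalance-# {x = x} {y} x≢y r s t r+s≡#x+#y = #x≡r , +-cancelˡ-≡ r _ _ (begin
  r + t′ # y                  ≡⟨ cong (_+ t′ # y) (sym #x≡r) ⟩
  t′ # x + t′ # y             ≡⟨ sym (∣pair∣ t′) ⟩
  ∣ fibre t′ x ∪ fibre t′ y ∣ ≡⟨ cong ∣_∣ pair-unchanged ⟩
  ∣ fibre t x ∪ fibre t y ∣   ≡⟨ ∣pair∣ t ⟩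
  t # x + t # y               ≡⟨ sym r+s≡#x+#y ⟩
  r + s                       ∎)
  where
  open ≡-Reasoning
  t′ = rebalance r x y t

  ∣pair∣ : (u : Vec (Fin _) _) → ∣ fibre u x ∪ fibre u y ∣ ≡ u # x + u # y
  ∣pair∣ u = ∣p∪q∣≡∣p∣+∣q∣ (fibre-disjoint u x≢y)

  inPair : Fin _ → Bool
  inPair z = does (z ≟ x) ∨ does (z ≟ y)

  inPair-x≡inPair-y : inPair x ≡ inPair y
  inPair-x≡inPair-y rewrite dec-true (x ≟ x) refl | dec-true (y ≟ y) refl = sym (∨-zeroʳ _)

  pair-unchanged : fibre t′ x ∪ fibre t′ y ≡ fibre t x ∪ fibre t y
  pair-unchanged = trans (zipWith-map-map _∨_ _ _ t′)
    (trans (rebalance-map inPair inPair-x≡inPair-y r t) (sym (zipWith-map-map _∨_ _ _ t)))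

  #x≡r : t′ # x ≡ r
  #x≡r = trans (rebalance-#ˡ x≢y r t)
    (trans (cong (r ⊓_) (trans (∣pair∣ t) (sym r+s≡#x+#y))) (m≤n⇒m⊓n≡m (m≤m+n r s)))

pattern a₁ = zero
pattern a₂ = suc zero
pattern a₃ = suc (suc zero)
pattern b₁ = suc (suc (suc zero))
pattern b₂ = suc (suc (suc (suc zero)))
pattern b₃ = suc (suc (suc (suc (suc zero))))
pattern c₁ = suc (suc (suc (suc (suc (suc zero)))))
pattern c₂ = suc (suc (suc (suc (suc (suc (suc zero))))))
pattern c₃ = suc (suc (suc (suc (suc (suc (suc (suc zero)))))))

parts : Fin 4 → Fin 9 × Fin 9 × Fin 9
parts zero                   = a₁ , b₁ , c₁
parts (suc zero)             = a₂ , b₂ , c₂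
parts (suc (suc zero))       = a₁ , b₃ , c₁
parts (suc (suc (suc zero))) = a₃ , b₂ , c₂

colour : ∀ {n} → Vec (Fin 9) n → Fin 4 → Subset n
colour t v = map (_∈₃ parts v) t

Balanced : ∀ {n} → Vec (Fin 9) n → Set
Balanced t = (t # a₁ ≡ t # a₂ × t # a₂ ≡ t # a₃) ×
             (t # b₁ ≡ t # b₂ × t # b₂ ≡ t # b₃) ×
             (t # c₁ ≡ t # c₂ × t # c₂ ≡ t # c₃)

classify-point : (p q r s : Bool) → p ∧ q ≡ false → q ∧ r ≡ false → r ∧ s ≡ false → s ∧ p ≡ false →
  ∃ λ x → p ≡ x ∈₃ parts v₁ × q ≡ x ∈₃ parts v₂ × r ≡ x ∈₃ parts v₃ × s ≡ x ∈₃ parts v₄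
classify-point false false false false _ _ _ _ = c₃ , refl , refl , refl , refl
classify-point true  false false false _ _ _ _ = b₁ , refl , refl , refl , refl
classify-point false true  false false _ _ _ _ = a₂ , refl , refl , refl , refl
classify-point false false true  false _ _ _ _ = b₃ , refl , refl , refl , refl
classify-point false false false true  _ _ _ _ = a₃ , refl , refl , refl , refl
classify-point true  false true  false _ _ _ _ = a₁ , refl , refl , refl , refl
classify-point false true  false true  _ _ _ _ = b₂ , refl , refl , refl , refl
classify-point true  true  _     _     () _  _  _
classify-point _     true  true  _     _  () _  _
classify-point _     _     true  true  _  _  () _
classify-point true  _     _     true  _  _  _  ()

colouring-as-partition : ∀ {n} (s₁ s₂ s₃ s₄ : Subset n) →
  Disjoint s₁ s₂ → Disjoint s₂ s₃ → Disjoint s₃ s₄ → Disjoint s₄ s₁ →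
  ∃ λ t → s₁ ≡ colour t v₁ × s₂ ≡ colour t v₂ × s₃ ≡ colour t v₃ × s₄ ≡ colour t v₄
colouring-as-partition [] [] [] [] _ _ _ _ = [] , refl , refl , refl , refl
colouring-as-partition (p ∷ s₁) (q ∷ s₂) (r ∷ s₃) (s ∷ s₄) d₁₂ d₂₃ d₃₄ d₄₁
  with classify-point p q r s (∷-injectiveˡ d₁₂) (∷-injectiveˡ d₂₃) (∷-injectiveˡ d₃₄) (∷-injectiveˡ d₄₁)
     | colouring-as-partition s₁ s₂ s₃ s₄ (∷-injectiveʳ d₁₂) (∷-injectiveʳ d₂₃) (∷-injectiveʳ d₃₄) (∷-injectiveʳ d₄₁)
... | x , refl , refl , refl , refl | t , refl , refl , refl , refl = x ∷ t , refl , refl , refl , refl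

margin-cong : ∀ {m} {φ ψ : Fin 4 → Subset (3 * m)} →
  φ v₁ ≡ ψ v₁ → φ v₂ ≡ ψ v₂ → φ v₃ ≡ ψ v₃ → φ v₄ ≡ ψ v₄ → margin m φ ≡ margin m ψ
margin-cong {m} e₁ e₂ e₃ e₄ =
  cong₂ _⊓_ (cong₂ _⊓_ (cong ∣_∣ (cong₂ _─_ e₁ e₃)) (cong ∣_∣ (cong₂ _─_ e₂ e₄)))
            (cong (λ u → 3 * m ∸ ∣ u ∣) (cong₂ _∪_ e₁ (cong₂ _∪_ e₂ (cong₂ _∪_ e₃ e₄))))

margin-colour : ∀ m (t : Vec (Fin 9) (3 * m)) → margin m (colour t) ≡ t # b₁ ⊓ t # a₂ ⊓ t # c₃
margin-colour m t = cong₂ _⊓_ (cong₂ _⊓_ (cong ∣_∣ v₁─v₃) (cong ∣_∣ v₂─v₄)) uncovered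
  where
  v₁─v₃ : colour t v₁ ─ colour t v₃ ≡ fibre t b₁
  v₁─v₃ = trans (zipWith-map-map _ _ _ t) (map-cong decide-≗ t)

  v₂─v₄ : colour t v₂ ─ colour t v₄ ≡ fibre t a₂
  v₂─v₄ = trans (zipWith-map-map _ _ _ t) (map-cong decide-≗ t)

  covered : colour t v₁ ∪ colour t v₂ ∪ colour t v₃ ∪ colour t v₄ ≡ ∁ (fibre t c₃)
  covered = trans (cong (λ p → colour t v₁ ∪ colour t v₂ ∪ p) (zipWith-map-map _ _ _ t))
           (trans (cong (colour t v₁ ∪_) (zipWith-map-map _ _ _ t))
           (trans (zipWith-map-map _ _ _ t)
           (trans (map-cong decide-≗ t) (map-∘ not _ t))))

  uncovered : 3 * m ∸ ∣ colour t v₁ ∪ colour t v₂ ∪ colour t v₃ ∪ colour t v₄ ∣ ≡ t # c₃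
  uncovered = trans (cong (λ p → 3 * m ∸ ∣ p ∣) covered)
    (trans (cong (3 * m ∸_) (∣∁p∣≡n∸∣p∣ (fibre t c₃))) (m∸[m∸n]≡n (∣p∣≤n (fibre t c₃))))

part-sizes : ∀ {m α₁ α₂ α₃ β₁ β₂ β₃ γ₁ γ₂ γ₃ : ℕ} →
  α₁ + (β₁ + γ₁) ≡ m → α₂ + (β₂ + γ₂) ≡ m → α₁ + (β₃ + γ₁) ≡ m → α₃ + (β₂ + γ₂) ≡ m →
  α₁ + (α₂ + (α₃ + (β₁ + (β₂ + (β₃ + (γ₁ + (γ₂ + (γ₃ + 0)))))))) ≡ 3 * m →
  α₂ ≡ α₃ × β₁ ≡ β₃ × α₂ + γ₃ ≡ α₁ + γ₁ × β₁ + γ₃ ≡ β₂ + γ₂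
part-sizes {α₁ = α₁} {α₂} {α₃} {β₁} {β₂} {β₃} {γ₁} {γ₂} {γ₃} refl ∣v₂∣ ∣v₃∣ ∣v₄∣ total
  with +-cancelʳ-≡ (β₂ + γ₂) α₃ α₂ (trans ∣v₄∣ (sym ∣v₂∣))
     | +-cancelʳ-≡ γ₁ β₃ β₁ (+-cancelˡ-≡ α₁ _ _ ∣v₃∣)
... | refl | refl =
  refl , refl ,
  +-cancelˡ-≡ β₁ _ _ (trans (swap β₁ α₂ γ₃) (trans margins (swap α₁ β₁ γ₁))) ,
  +-cancelˡ-≡ α₂ _ _ (trans margins (sym ∣v₂∣))
  where
  M = α₁ + (β₁ + γ₁)

  swap : ∀ a b c → a + (b + c) ≡ b + (a + c)
  swap = solve-∀

  regroup : ∀ a b c d e f g → a + (b + (b + (c + (d + (c + (e + (f + (g + 0))))))))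
                            ≡ (a + (c + e)) + ((b + (d + f)) + (b + (c + g)))
  regroup = solve-∀

  margins : α₂ + (β₁ + γ₃) ≡ M
  margins = trans (+-cancelˡ-≡ M _ _ (+-cancelˡ-≡ M _ _ (begin
      M + (M + (α₂ + (β₁ + γ₃)))                 ≡⟨ cong (λ w → M + (w + (α₂ + (β₁ + γ₃)))) (sym ∣v₂∣) ⟩
      M + ((α₂ + (β₂ + γ₂)) + (α₂ + (β₁ + γ₃)))  ≡⟨ trans (sym (regroup α₁ α₂ β₁ β₂ γ₁ γ₂ γ₃)) total ⟩
      M + (M + (M + 0))                           ∎)))
    (+-identityʳ M)
    where open ≡-Reasoning

a₁∼c₁ : ∀ v → a₁ ∈₃ parts v ≡ c₁ ∈₃ parts v
a₁∼c₁ = decide-≗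

b₂∼c₂ : ∀ v → b₂ ∈₃ parts v ≡ c₂ ∈₃ parts v
b₂∼c₂ = decide-≗

balance : ∀ {n} (t₀ : Vec (Fin 9) n) →
  t₀ # a₂ ≡ t₀ # a₃ → t₀ # b₁ ≡ t₀ # b₃ →
  t₀ # a₂ + t₀ # c₃ ≡ t₀ # a₁ + t₀ # c₁ → t₀ # b₁ + t₀ # c₃ ≡ t₀ # b₂ + t₀ # c₂ →
  ∃ λ t → (∀ v → colour t v ≡ colour t₀ v) × Balanced t
balance t₀ #a₂≡#a₃ #b₁≡#b₃ #a₁c₁ #b₂c₂ = t , same-colours ,
  (trans (kept₂ a₁ refl) (trans (proj₁ sizes-a₁c₁) (sym (unchanged a₂ refl refl))) ,
   trans (unchanged a₂ refl refl) (trans #a₂≡#a₃ (sym (unchanged a₃ refl refl)))) ,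
  (trans (unchanged b₁ refl refl) (sym (proj₁ sizes-b₂c₂)) ,
   trans (proj₁ sizes-b₂c₂) (trans #b₁≡#b₃ (sym (unchanged b₃ refl refl)))) ,
  (trans (kept₂ c₁ refl) (trans (proj₂ sizes-a₁c₁) (sym (proj₂ sizes-b₂c₂))) ,
   trans (proj₂ sizes-b₂c₂) (sym (unchanged c₃ refl refl)))
  where
  t₁ t : Vec (Fin 9) _
  t₁ = rebalance (t₀ # a₂) a₁ c₁ t₀
  t  = rebalance (t₀ # b₁) b₂ c₂ t₁

  kept₁ : ∀ i → does (a₁ ≟ i) ≡ does (c₁ ≟ i) → t₁ # i ≡ t₀ # i
  kept₁ i e = cong ∣_∣ (rebalance-map (λ x → does (x ≟ i)) e _ t₀)

  kept₂ : ∀ i → does (b₂ ≟ i) ≡ does (c₂ ≟ i) → t # i ≡ t₁ # i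
  kept₂ i e = cong ∣_∣ (rebalance-map (λ x → does (x ≟ i)) e _ t₁)

  unchanged : ∀ i → does (a₁ ≟ i) ≡ does (c₁ ≟ i) → does (b₂ ≟ i) ≡ does (c₂ ≟ i) → t # i ≡ t₀ # i
  unchanged i e₁ e₂ = trans (kept₂ i e₂) (kept₁ i e₁)

  sizes-a₁c₁ : t₁ # a₁ ≡ t₀ # a₂ × t₁ # c₁ ≡ t₀ # c₃
  sizes-a₁c₁ = rebalance-# (λ ()) (t₀ # a₂) (t₀ # c₃) t₀ #a₁c₁

  sizes-b₂c₂ : t # b₂ ≡ t₀ # b₁ × t # c₂ ≡ t₀ # c₃
  sizes-b₂c₂ = rebalance-# (λ ()) (t₀ # b₁) (t₀ # c₃) t₁
    (trans #b₂c₂ (sym (cong₂ _+_ (kept₁ b₂ refl) (kept₁ c₂ refl))))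

  same-colours : ∀ v → colour t v ≡ colour t₀ v
  same-colours v = trans (rebalance-map (_∈₃ parts v) (b₂∼c₂ v) _ t₁)
                         (rebalance-map (_∈₃ parts v) (a₁∼c₁ v) _ t₀)

balanced-partition : ∀ m (s₁ s₂ s₃ s₄ : Subset (3 * m)) →
  Disjoint s₁ s₂ → Disjoint s₂ s₃ → Disjoint s₃ s₄ → Disjoint s₄ s₁ →
  ∣ s₁ ∣ ≡ m → ∣ s₂ ∣ ≡ m → ∣ s₃ ∣ ≡ m → ∣ s₄ ∣ ≡ m →
  ∃ λ t → (s₁ ≡ colour t v₁ × s₂ ≡ colour t v₂ × s₃ ≡ colour t v₃ × s₄ ≡ colour t v₄) × Balanced t
balanced-partition m s₁ s₂ s₃ s₄ d₁₂ d₂₃ d₃₄ d₄₁ ∣s₁∣ ∣s₂∣ ∣s₃∣ ∣s₄∣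
  with colouring-as-partition s₁ s₂ s₃ s₄ d₁₂ d₂₃ d₃₄ d₄₁
... | t₀ , refl , refl , refl , refl
  with part-sizes {m} {t₀ # a₁} {t₀ # a₂} {t₀ # a₃} {t₀ # b₁} {t₀ # b₂} {t₀ # b₃} {t₀ # c₁} {t₀ # c₂} {t₀ # c₃}
                  (trans (sym (∣fibres-∪₃∣ t₀ a₁ b₁ c₁ (λ ()) (λ ()) (λ ()))) ∣s₁∣)
                  (trans (sym (∣fibres-∪₃∣ t₀ a₂ b₂ c₂ (λ ()) (λ ()) (λ ()))) ∣s₂∣)
                  (trans (sym (∣fibres-∪₃∣ t₀ a₁ b₃ c₁ (λ ()) (λ ()) (λ ()))) ∣s₃∣)
                  (trans (sym (∣fibres-∪₃∣ t₀ a₃ b₂ c₂ (λ ()) (λ ()) (λ ()))) ∣s₄∣)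
                  (sum-fibres t₀)
... | #a₂≡#a₃ , #b₁≡#b₃ , #a₁c₁ , #b₂c₂
  with balance t₀ #a₂≡#a₃ #b₁≡#b₃ #a₁c₁ #b₂c₂
... | t , same , balanced = t , (sym (same v₁) , sym (same v₂) , sym (same v₃) , sym (same v₄)) , balanced

lemma20 : (m : ℕ) → 1 ≤ m → (φ : Fin 4 → Subset (3 * m)) → IsC4ColouringOf (3 * m) m φ →
    (b : ℕ) → margin m φ ≡ b →
    Σ (Subset (3 * m)) λ A₁ → Σ (Subset (3 * m)) λ A₂ → Σ (Subset (3 * m)) λ A₃ →
    Σ (Subset (3 * m)) λ B₁ → Σ (Subset (3 * m)) λ B₂ → Σ (Subset (3 * m)) λ B₃ →
    Σ (Subset (3 * m)) λ C₁ → Σ (Subset (3 * m)) λ C₂ → Σ (Subset (3 * m)) λ C₃ →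
      PairwiseDisjoint (lookup (A₁ ∷ A₂ ∷ A₃ ∷ B₁ ∷ B₂ ∷ B₃ ∷ C₁ ∷ C₂ ∷ C₃ ∷ [])) ×
      (∣ A₁ ∣ ≡ ∣ A₂ ∣ × ∣ A₂ ∣ ≡ ∣ A₃ ∣ × b ≤ ∣ A₁ ∣) ×
      (∣ B₁ ∣ ≡ ∣ B₂ ∣ × ∣ B₂ ∣ ≡ ∣ B₃ ∣ × b ≤ ∣ B₁ ∣) ×
      (∣ C₁ ∣ ≡ ∣ C₂ ∣ × ∣ C₂ ∣ ≡ ∣ C₃ ∣ × b ≤ ∣ C₁ ∣) ×
      φ v₁ ≡ A₁ ∪ B₁ ∪ C₁ × φ v₂ ≡ A₂ ∪ B₂ ∪ C₂ ×
      φ v₃ ≡ A₁ ∪ B₃ ∪ C₁ × φ v₄ ≡ A₃ ∪ B₂ ∪ C₂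
lemma20 m _ φ ((d₁₂ , d₂₃ , d₃₄ , d₄₁) , ∣φ∣) b refl
  with balanced-partition m (φ v₁) (φ v₂) (φ v₃) (φ v₄) d₁₂ d₂₃ d₃₄ d₄₁ (∣φ∣ v₁) (∣φ∣ v₂) (∣φ∣ v₃) (∣φ∣ v₄)
... | t , (φ₁ , φ₂ , φ₃ , φ₄) , (a₁≡a₂ , a₂≡a₃) , (b₁≡b₂ , b₂≡b₃) , (c₁≡c₂ , c₂≡c₃) =
  fibre t a₁ , fibre t a₂ , fibre t a₃ , fibre t b₁ , fibre t b₂ , fibre t b₃ , fibre t c₁ , fibre t c₂ , fibre t c₃ ,
  fibres-pairwiseDisjoint t ,
  (a₁≡a₂ , a₂≡a₃ , bound (≤-trans (m⊓n≤m _ _) (≤-trans (m⊓n≤n _ _) (≤-reflexive (sym a₁≡a₂))))) ,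
  (b₁≡b₂ , b₂≡b₃ , bound (≤-trans (m⊓n≤m _ _) (m⊓n≤m _ _))) ,
  (c₁≡c₂ , c₂≡c₃ , bound (≤-trans (m⊓n≤n _ _) (≤-reflexive (sym (trans c₁≡c₂ c₂≡c₃))))) ,
  trans φ₁ (sym (fibres-∪₃ t a₁ b₁ c₁)) , trans φ₂ (sym (fibres-∪₃ t a₂ b₂ c₂)) ,
  trans φ₃ (sym (fibres-∪₃ t a₁ b₃ c₁)) , trans φ₄ (sym (fibres-∪₃ t a₃ b₂ c₂))
  where
  bound : ∀ {x} → t # b₁ ⊓ t # a₂ ⊓ t # c₃ ≤ x → margin m φ ≤ x
  bound = ≤-trans (≤-reflexive (trans (margin-cong {m} {φ} {colour t} φ₁ φ₂ φ₃ φ₄) (margin-colour m t)))
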